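{- Let $G=(V,E)$ be a digraph with block graph $F$. Let $u$ and $v$ be vertices of $V$ that are connected by a path $P$ in $F$. Then, for any vertex $w\in V$ not on $P$, $u$ and $v$ are strongly connected in the digraph $G\setminus w$.
   Context: Two distinct vertices $v,w$ of $G$ are vertex-resilient, written $v\leftrightarrow_{\mathrm{vr}} w$, if for every vertex $z\notin\{v,w\}$, $v$ and $w$ lie in the same strongly connected component of $G\setminus z$. A vertex-resilient block is a maximal set $B\subseteq V$ with $|B|\ge 2$ such that $u\leftrightarrow_{\mathrm{vr}} v$ for all distinct $u,v\in B$. The block graph $F$ of $G$ is the undirected bipartite graph whose vertex set consists of the vertices of $V$ together with one block node for each vertex-resilient block of $G$, and whose edges are the pairs $\{u,B\}$ with $u\in B$. -}

module Defs where

open import Data.Nat using (ℕ; _≤_)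
open import Data.Fin using (Fin)
open import Data.Fin.Subset using (Subset; _∈_; _⊆_; ∣_∣)
open import Data.Sum using (_⊎_; inj₁; inj₂)
open import Data.Product using (_×_)
open import Data.Empty using (⊥)
open import Data.List using (List; []; _∷_)
open import Relation.Binary.PropositionalEquality using (_≡_; _≢_)

Digraph : ℕ → Set₁
Digraph n = Fin n → Fin n → Set

module _ {n : ℕ} (E : Digraph n) where

  -- Reach z x y : there is a directed path from x to y in G ∖ z
  -- (all vertices of the path, including endpoints, differ from z).
  data Reach (z : Fin n) : Fin n → Fin n → Set where
    here  : ∀ {x} → x ≢ z → Reach z x x
    step  : ∀ {x y t} → x ≢ z → E x y → Reach z y t → Reach z x t

  StronglyConnectedWithout : Fin n → Fin n → Fin n → Set
  StronglyConnectedWithout z x y = Reach z x y × Reach z y x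

  VR : Fin n → Fin n → Set
  VR v w = v ≢ w × (∀ z → z ≢ v → z ≢ w → StronglyConnectedWithout z v w)

  PairwiseVR : Subset n → Set
  PairwiseVR B = ∀ x y → x ∈ B → y ∈ B → x ≢ y → VR x y

  IsBlock : Subset n → Set
  IsBlock B = 2 ≤ ∣ B ∣ × PairwiseVR B × (∀ B′ → B ⊆ B′ → PairwiseVR B′ → B′ ⊆ B)

  -- Nodes of the block graph F: vertex nodes inj₁ v, block nodes inj₂ B (B a block).
  FNode : Set
  FNode = Fin n ⊎ Subset n

  FAdj : FNode → FNode → Set
  FAdj (inj₁ u) (inj₁ v) = ⊥
  FAdj (inj₁ u) (inj₂ B) = IsBlock B × u ∈ B
  FAdj (inj₂ B) (inj₁ u) = IsBlock B × u ∈ B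
  FAdj (inj₂ B) (inj₂ C) = ⊥

  data FWalk : FNode → FNode → Set where
    []  : ∀ {x} → FWalk x x
    _∷_ : ∀ {x y z} → FAdj x y → FWalk y z → FWalk x z

  nodes : ∀ {x y} → FWalk x y → List FNode
  nodes {x} []      = x ∷ []
  nodes {x} (_ ∷ p) = x ∷ nodes p

-- A walk in the bipartite block graph F from a vertex u to a vertex v
-- alternates vertex nodes and block nodes: u = x₀ B₁ x₁ B₂ … Bₖ xₖ = v with
-- xᵢ₋₁, xᵢ ∈ Bᵢ.  If w is not on the walk, then w ∉ {xᵢ₋₁, xᵢ}, so the
-- vertex-resilience of the block Bᵢ makes xᵢ₋₁ and xᵢ strongly connected in
-- G ∖ w; chaining these by transitivity of strong connectivity in G ∖ w
-- gives the claim.  The argument works for arbitrary walks.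
module Submission where

open import Defs
open import Data.Nat using (ℕ)
open import Data.Fin using (Fin; _≟_)
open import Data.Fin.Subset using (_∈_)
open import Data.Sum using (inj₁; inj₂)
open import Data.Product using (_,_)
open import Data.List.Membership.Propositional using (_∉_)
open import Data.List.Relation.Unary.Any using (here; there)
open import Data.List.Relation.Unary.Unique.Propositional using (Unique)
open import Relation.Binary.PropositionalEquality using (_≡_; _≢_; refl; sym; cong)
open import Relation.Nullary using (yes; no)

module _ {n : ℕ} (E : Digraph n) where

  reach-trans : ∀ {z x y t} → Reach E z x y → Reach E z y t → Reach E z x t
  reach-trans (here _)       q = q
  reach-trans (step x≢z e p) q = step x≢z e (reach-trans p q)

  sc-refl : ∀ {z x} → x ≢ z → StronglyConnectedWithout E z x x
  sc-refl x≢z = here x≢z , here x≢z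

  sc-trans : ∀ {z x y t} → StronglyConnectedWithout E z x y →
             StronglyConnectedWithout E z y t → StronglyConnectedWithout E z x t
  sc-trans (xy , yx) (yt , ty) = reach-trans xy yt , reach-trans ty yx

  pairwiseVR-sc : ∀ {B x y w} → PairwiseVR E B → x ∈ B → y ∈ B →
                  w ≢ x → w ≢ y → StronglyConnectedWithout E w x y
  pairwiseVR-sc {x = x} {y} vrB x∈B y∈B w≢x w≢y with x ≟ y
  ... | yes refl = sc-refl (λ x≡w → w≢x (sym x≡w))
  ... | no  x≢y  with vrB x y x∈B y∈B x≢y
  ...   | _ , resilient = resilient _ w≢x w≢y

  start-on-walk : ∀ {x a w} (P : FWalk E (inj₁ x) a) →
                  inj₁ w ∉ nodes E P → w ≢ x
  start-on-walk []      w∉P w≡x = w∉P (here (cong inj₁ w≡x))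
  start-on-walk (_ ∷ _) w∉P w≡x = w∉P (here (cong inj₁ w≡x))

  walk-sc : ∀ {u v} (P : FWalk E (inj₁ u) (inj₁ v)) (w : Fin n) →
            inj₁ w ∉ nodes E P → StronglyConnectedWithout E w u v
  walk-sc [] w w∉P = sc-refl (λ u≡w → start-on-walk [] w∉P (sym u≡w))
  walk-sc (_∷_ {y = inj₁ _} () _) w w∉P
  walk-sc (_∷_ {y = inj₂ _} _ (_∷_ {y = inj₂ _} () _)) w w∉P
  walk-sc P@(_∷_ {y = inj₂ B} ((_ , vrB , _) , u∈B)
              (_∷_ {y = inj₁ x} (_ , x∈B) rest)) w w∉P =
    sc-trans (pairwiseVR-sc vrB u∈B x∈B (start-on-walk P w∉P) w≢x)
             (walk-sc rest w w∉rest)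
    where
      w∉rest : inj₁ w ∉ nodes E rest
      w∉rest w∈rest = w∉P (there (there w∈rest))

      w≢x : w ≢ x
      w≢x = start-on-walk rest w∉rest

lemma2 : {n : ℕ} (E : Digraph n) (u v : Fin n) (P : FWalk E (inj₁ u) (inj₁ v)) →
    Unique (nodes E P) →
    (w : Fin n) → inj₁ w ∉ nodes E P →
    StronglyConnectedWithout E w u v
lemma2 E u v P _ = walk-sc E P
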